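{- For all integers $n\geq 3$ and $t \geq 3$, the Italian domination number of the Sierpi\'{n}ski graph $S(K_n,t)$ is $\gamma_I(S(K_n,t)) = n^{t-2}(2n-2)$.
   Context: Sierpi\'{n}ski graph: for $n\ge 2$ and a positive integer $t$, $S(K_n,t)$ has as vertex set the set of words $u=u_1u_2\cdots u_t$ of length $t$ over the alphabet $V(K_n)=\{v_1,\dots,v_n\}$; two words $u,v$ are adjacent if and only if there is $i\in\{1,\dots,t\}$ such that $u_j=v_j$ for $j<i$, $u_i\neq v_i$, and $u_j=v_i$ and $v_j=u_i$ for all $j>i$. An Italian dominating function (IDF) of a graph $G$ is a function $f:V(G)\to\{0,1,2\}$ such that every vertex $v$ with $f(v)=0$ satisfies $\sum_{u\in N(v)} f(u)\ge 2$, where $N(v)$ is the open neighbourhood of $v$. The weight of $f$ is $\sum_{v\in V(G)} f(v)$, and the Italian domination number $\gamma_I(G)$ is the minimum weight of an IDF of $G$. -}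

module Defs where

open import Data.Nat using (ℕ; zero; suc; _≤_)
open import Data.Fin using (Fin; _<_; _≟_)
open import Data.Fin.Properties using (_<?_; all?; any?)
open import Data.Vec using (Vec; []; _∷_; lookup)
open import Data.List using (List; map; concatMap; allFin; [_])
open import Data.Nat.ListAction using (sum)
open import Data.Product using (_×_; Σ; ∃)
open import Relation.Nullary using (¬_; Dec; yes; no)
open import Relation.Nullary.Decidable using (_×-dec_; _→-dec_; ¬?)
open import Relation.Binary.PropositionalEquality using (_≡_)

-- Vertices of the Sierpinski graph S(K_n, t): words of length t over the
-- alphabet Fin n (letter k : Fin n stands for the vertex v_{k+1} of K_n).
Word : ℕ → ℕ → Set
Word n t = Vec (Fin n) t

AdjAt : ∀ {n t} → Fin t → Word n t → Word n t → Set
AdjAt {n} {t} i u v =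
  ((j : Fin t) → j < i → lookup u j ≡ lookup v j)
  × (¬ (lookup u i ≡ lookup v i))
  × ((j : Fin t) → i < j → (lookup u j ≡ lookup v i) × (lookup v j ≡ lookup u i))

Adj : ∀ {n t} → Word n t → Word n t → Set
Adj {n} {t} u v = ∃ λ (i : Fin t) → AdjAt i u v

adjAt? : ∀ {n t} (i : Fin t) (u v : Word n t) → Dec (AdjAt i u v)
adjAt? i u v =
  all? (λ j → (j <? i) →-dec (lookup u j ≟ lookup v j))
  ×-dec ¬? (lookup u i ≟ lookup v i)
  ×-dec all? (λ j → (i <? j) →-dec ((lookup u j ≟ lookup v i) ×-dec (lookup v j ≟ lookup u i)))

adj? : ∀ {n t} (u v : Word n t) → Dec (Adj u v)
adj? u v = any? (λ i → adjAt? i u v)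

allWords : (n t : ℕ) → List (Word n t)
allWords n zero    = [ [] ]
allWords n (suc t) = concatMap (λ a → map (a ∷_) (allWords n t)) (allFin n)

nbrSum : ∀ {n t} → (Word n t → ℕ) → Word n t → ℕ
nbrSum {n} {t} f v = sum (map (λ u → weightIf (adj? v u) (f u)) (allWords n t))
  where
  weightIf : ∀ {A : Set} → Dec A → ℕ → ℕ
  weightIf (yes _) m = m
  weightIf (no _)  _ = 0

weight : ∀ {n t} → (Word n t → ℕ) → ℕ
weight {n} {t} f = sum (map f (allWords n t))

IsIDF : (n t : ℕ) → (Word n t → ℕ) → Set
IsIDF n t f = ((v : Word n t) → f v ≤ 2)
            × ((v : Word n t) → f v ≡ 0 → 2 ≤ nbrSum f v)

ItalianDominationNumber : (n t m : ℕ) → Set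
ItalianDominationNumber n t m =
  (Σ (Word n t → ℕ) λ f → IsIDF n t f × weight f ≡ m)
  × ((f : Word n t → ℕ) → IsIDF n t f → m ≤ weight f)

{-# OPTIONS --safe #-}
module Submission where

-- Summing the neighbour sums of an IDF f counts every value f u at most deg u ≤ n
-- times, so n · w(f) ≥ Σ_v Σ_{u ∈ N(v)} f u. The vertex set is partitioned into n^(t-1) cliques
-- K_n (words differing only in the last letter), and the neighbour sums over each clique add up to
-- at least 2n − 2: if the clique carries weight ≤ 1, every vertex collects 2 from its neighbours
-- and itself; otherwise every vertex already sees the weight ≥ 2 of the rest of the clique.
--
-- With l⁻ and l⁺ the cyclic predecessor and successor of l (distinct since n ≥ 3),
-- put 1 on the words ending in l x l⁻, and 1 on those ending in l x l⁺ with x ∉ {l⁻, l⁺}. Each of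
-- the n^(t-2) blocks of words with a fixed prefix then weighs n + (n − 2). A vertex …l x y of
-- weight 0 has y ≠ l⁻, so its clique neighbour …l x l⁻ carries 1; a second unit is found at
-- …l x l⁺, or across the bridge edge to …l y x, or, when x = y = l⁺, across the bridge to …l⁺ l l.

open import Defs
open import Data.Nat using (ℕ; zero; suc; _+_; _*_; _∸_; _^_; _≤_; _≤?_; z≤n; s≤s; NonZero)
open import Data.Nat.Properties hiding (_≟_)
import Data.Nat as ℕ
open import Data.Nat.ListAction using () renaming (sum to listSum)
open import Data.Nat.ListAction.Properties using (sum-++)
open import Data.Fin using (Fin; zero; suc; _≟_; toℕ; fromℕ; fromℕ<; inject₁)
import Data.Fin as Fin
import Data.Fin.Properties as Fin
open import Data.Vec using (Vec; []; _∷_; lookup; replicate)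
open import Data.Vec.Properties using (∷-injective; lookup-replicate; ≡-dec)
open import Data.List using (List; map; concatMap; allFin; tabulate; _++_) renaming ([] to []ˡ; _∷_ to _∷ˡ_)
open import Data.List.Properties using (map-++; map-∘; map-cong; map-tabulate)
open import Data.Product using (_×_; _,_; proj₁; proj₂)
open import Data.Empty using (⊥-elim)
open import Relation.Nullary using (¬_; Dec; yes; no)
open import Relation.Binary.PropositionalEquality
open import Function using (_∘_; id)
open import Algebra.Properties.Semiring.Sum +-*-semiring
  using (sum; sum-syntax; sum-cong-≗; ∑-distrib-+; ∑-comm; *-distribˡ-sum)
open import Algebra.Properties.CommutativeSemigroup *-commutativeSemigroup using (x∙yz≈y∙xz; x∙yz≈z∙xy)

_≟ʷ_ : ∀ {n t} (u v : Word n t) → Dec (u ≡ v)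
_≟ʷ_ = ≡-dec _≟_

private variable A B C : Set

when : Dec A → ℕ → ℕ
when (yes _) m = m
when (no _)  _ = 0

unless : Dec A → ℕ → ℕ
unless (yes _) _ = 0
unless (no _)  m = m

when-yes : A → (d : Dec A) → ∀ m → when d m ≡ m
when-yes a (yes _) m = refl
when-yes a (no ¬a) m = ⊥-elim (¬a a)

when-no : ¬ A → (d : Dec A) → ∀ m → when d m ≡ 0
when-no ¬a (yes a) m = ⊥-elim (¬a a)
when-no ¬a (no _)  m = refl

unless-no : ¬ A → (d : Dec A) → ∀ m → unless d m ≡ m
unless-no ¬a (yes a) m = ⊥-elim (¬a a)
unless-no ¬a (no _)  m = refl

when+unless : (d : Dec A) → ∀ m → when d m + unless d m ≡ m
when+unless (yes _) m = +-identityʳ m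
when+unless (no _)  m = refl

when-≤ : (d : Dec A) → ∀ m → when d m ≤ m
when-≤ (yes _) m = ≤-refl
when-≤ (no _)  m = z≤n

unless-≤ : (d : Dec A) → ∀ m → unless d m ≤ m
unless-≤ (yes _) m = z≤n
unless-≤ (no _)  m = ≤-refl

when-cong : (A → B) → (B → A) → (d : Dec A) (e : Dec B) → ∀ m → when d m ≡ when e m
when-cong to from (yes a) e m = sym (when-yes (to a) e m)
when-cong to from (no ¬a) e m = sym (when-no (¬a ∘ from) e m)

when-× : (B → C → A) → (A → B) → (A → C) →
         (d : Dec A) (e : Dec B) (c : Dec C) → ∀ m → when d m ≡ when e (when c m)
when-× pair fst snd d (yes b) (yes c) m = when-yes (pair b c) d m
when-× pair fst snd d (yes b) (no ¬c) m = when-no (¬c ∘ snd) d m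
when-× pair fst snd d (no ¬b) c       m = when-no (¬b ∘ fst) d m

∑-const : ∀ k c → ∑[ i < k ] c ≡ k * c
∑-const zero    c = refl
∑-const (suc k) c = cong (c +_) (∑-const k c)

∑-mono-≤ : ∀ {k} {g h : Fin k → ℕ} → (∀ i → g i ≤ h i) → sum g ≤ sum h
∑-mono-≤ {zero}  g≤h = z≤n
∑-mono-≤ {suc k} g≤h = +-mono-≤ (g≤h zero) (∑-mono-≤ (g≤h ∘ suc))

∑-zero : ∀ {k} {g : Fin k → ℕ} → (∀ i → g i ≡ 0) → sum g ≡ 0
∑-zero {k} g≡0 = trans (sum-cong-≗ g≡0) (trans (∑-const k 0) (*-zeroʳ k))

∑-when-≟ : ∀ {k} (c : Fin k) (g : Fin k → ℕ) → ∑[ b < k ] when (c ≟ b) (g b) ≡ g c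
∑-when-≟ zero g =
  trans (cong (g zero +_) (∑-zero (λ b → when-no (λ ()) (zero ≟ suc b) (g (suc b)))))
        (+-identityʳ (g zero))
∑-when-≟ (suc c) g =
  trans (sum-cong-≗ (λ b → when-cong Fin.suc-injective (cong suc) (suc c ≟ suc b) (c ≟ b) (g (suc b))))
        (∑-when-≟ c (g ∘ suc))

∑-unless-≟ : ∀ {k} (c : Fin k) (g : Fin k → ℕ) → ∑[ b < k ] unless (c ≟ b) (g b) + g c ≡ sum g
∑-unless-≟ {k} c g = begin
  ∑[ b < k ] unless (c ≟ b) (g b) + g c
    ≡⟨ +-comm _ (g c) ⟩
  g c + ∑[ b < k ] unless (c ≟ b) (g b)
    ≡⟨ cong (_+ ∑[ b < k ] unless (c ≟ b) (g b)) (∑-when-≟ c g) ⟨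
  ∑[ b < k ] when (c ≟ b) (g b) + ∑[ b < k ] unless (c ≟ b) (g b)
    ≡⟨ ∑-distrib-+ (λ b → when (c ≟ b) (g b)) (λ b → unless (c ≟ b) (g b)) ⟨
  ∑[ b < k ] (when (c ≟ b) (g b) + unless (c ≟ b) (g b))
    ≡⟨ sum-cong-≗ (λ b → when+unless (c ≟ b) (g b)) ⟩
  sum g ∎
  where open ≡-Reasoning

term≤∑ : ∀ {k} (c : Fin k) (g : Fin k → ℕ) → g c ≤ sum g
term≤∑ c g = subst (g c ≤_) (trans (+-comm (g c) _) (∑-unless-≟ c g)) (m≤m+n (g c) _)

two-terms≤∑ : ∀ {k} {c d : Fin k} → c ≢ d → (g : Fin k → ℕ) → g c + g d ≤ sum g
two-terms≤∑ {c = c} {d} c≢d g =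
  subst (g c + g d ≤_) (trans (+-comm (g c) _) (∑-unless-≟ c g))
    (+-monoʳ-≤ (g c) (subst (_≤ _) (unless-no c≢d (c ≟ d) (g d))
                                   (term≤∑ d (λ b → unless (c ≟ b) (g b)))))

sumWords : ∀ {n t} → (Word n t → ℕ) → ℕ
sumWords {t = zero}  g = g []
sumWords {t = suc t} g = ∑[ a < _ ] sumWords (λ w → g (a ∷ w))

listSum-concatMap : ∀ {X Y : Set} (g : Y → ℕ) (h : X → List Y) (xs : List X) →
  listSum (map g (concatMap h xs)) ≡ listSum (map (λ x → listSum (map g (h x))) xs)
listSum-concatMap g h []ˡ        = refl
listSum-concatMap g h (x ∷ˡ xs) = begin
  listSum (map g (h x ++ concatMap h xs))                  ≡⟨ cong listSum (map-++ g (h x) _) ⟩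
  listSum (map g (h x) ++ map g (concatMap h xs))          ≡⟨ sum-++ (map g (h x)) _ ⟩
  listSum (map g (h x)) + listSum (map g (concatMap h xs)) ≡⟨ cong (_ +_) (listSum-concatMap g h xs) ⟩
  _ ∎
  where open ≡-Reasoning

listSum-tabulate : ∀ {k} (g : Fin k → ℕ) → listSum (tabulate g) ≡ sum g
listSum-tabulate {zero}  g = refl
listSum-tabulate {suc k} g = cong (g zero +_) (listSum-tabulate (g ∘ suc))

listSum-allFin : ∀ {k} (g : Fin k → ℕ) → listSum (map g (allFin k)) ≡ sum g
listSum-allFin g = trans (cong listSum (map-tabulate id g)) (listSum-tabulate g)

sum-allWords : ∀ {n t} (g : Word n t → ℕ) → listSum (map g (allWords n t)) ≡ sumWords g
sum-allWords {t = zero}  g = +-identityʳ (g [])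
sum-allWords {n} {suc t} g = begin
  listSum (map g (concatMap (λ a → map (a ∷_) (allWords n t)) (allFin n)))
    ≡⟨ listSum-concatMap g _ (allFin n) ⟩
  listSum (map (λ a → listSum (map g (map (a ∷_) (allWords n t)))) (allFin n))
    ≡⟨ cong listSum (map-cong (λ a → trans (cong listSum (sym (map-∘ (allWords n t))))
                                           (sum-allWords (λ w → g (a ∷ w)))) (allFin n)) ⟩
  listSum (map (λ a → sumWords (λ w → g (a ∷ w))) (allFin n))
    ≡⟨ listSum-allFin (λ a → sumWords (λ w → g (a ∷ w))) ⟩
  sumWords g ∎
  where open ≡-Reasoning

sumWords-cong : ∀ {n t} {g h : Word n t → ℕ} → (∀ w → g w ≡ h w) → sumWords g ≡ sumWords h
sumWords-cong {t = zero}  g≡h = g≡h []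
sumWords-cong {t = suc t} g≡h = sum-cong-≗ (λ a → sumWords-cong (λ w → g≡h (a ∷ w)))

sumWords-distrib-+ : ∀ {n t} (g h : Word n t → ℕ) → sumWords (λ w → g w + h w) ≡ sumWords g + sumWords h
sumWords-distrib-+ {t = zero}  g h = refl
sumWords-distrib-+ {t = suc t} g h =
  trans (sum-cong-≗ (λ a → sumWords-distrib-+ (λ w → g (a ∷ w)) (λ w → h (a ∷ w))))
        (∑-distrib-+ (λ a → sumWords (λ w → g (a ∷ w))) (λ a → sumWords (λ w → h (a ∷ w))))

sumWords-zero : ∀ {n t} {g : Word n t → ℕ} → (∀ w → g w ≡ 0) → sumWords g ≡ 0
sumWords-zero {t = zero}  g≡0 = g≡0 []
sumWords-zero {t = suc t} g≡0 = ∑-zero (λ a → sumWords-zero (λ w → g≡0 (a ∷ w)))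

sumWords-when : ∀ {n t} (d : Dec A) (g : Word n t → ℕ) →
  sumWords (λ w → when d (g w)) ≡ when d (sumWords g)
sumWords-when (yes _) g = refl
sumWords-when {n = n} {t} (no _)  g = sumWords-zero {n} {t} (λ _ → refl)

sumWords-unless : ∀ {n t} (d : Dec A) (g : Word n t → ℕ) →
  sumWords (λ w → unless d (g w)) ≡ unless d (sumWords g)
sumWords-unless {n = n} {t} (yes _) g = sumWords-zero {n} {t} (λ _ → refl)
sumWords-unless (no _)  g = refl

sumWords-when-≟ : ∀ {n t} (z : Word n t) (g : Word n t → ℕ) →
  sumWords (λ w → when (w ≟ʷ z) (g w)) ≡ g z
sumWords-when-≟ {n} [] g = when-yes refl (_≟ʷ_ {n} [] []) (g [])
sumWords-when-≟ {n} (c ∷ z) g = begin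
  ∑[ a < n ] sumWords (λ w → when ((a ∷ w) ≟ʷ (c ∷ z)) (g (a ∷ w)))
    ≡⟨ sum-cong-≗ (λ a → sumWords-cong (λ w → when-×
         (λ { refl refl → refl }) (sym ∘ proj₁ ∘ ∷-injective) (proj₂ ∘ ∷-injective)
         ((a ∷ w) ≟ʷ (c ∷ z)) (c ≟ a) (w ≟ʷ z) (g (a ∷ w)))) ⟩
  ∑[ a < n ] sumWords (λ w → when (c ≟ a) (when (w ≟ʷ z) (g (a ∷ w))))
    ≡⟨ sum-cong-≗ (λ a → sumWords-when (c ≟ a) (λ w → when (w ≟ʷ z) (g (a ∷ w)))) ⟩
  ∑[ a < n ] when (c ≟ a) (sumWords (λ w → when (w ≟ʷ z) (g (a ∷ w))))
    ≡⟨ ∑-when-≟ c (λ a → sumWords (λ w → when (w ≟ʷ z) (g (a ∷ w)))) ⟩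
  sumWords (λ w → when (w ≟ʷ z) (g (c ∷ w)))
    ≡⟨ sumWords-when-≟ z (λ w → g (c ∷ w)) ⟩
  g (c ∷ z) ∎
  where open ≡-Reasoning

sumWords-∑ : ∀ {n t k} (g : Word n t → Fin k → ℕ) →
  sumWords (λ w → ∑[ b < k ] g w b) ≡ ∑[ b < k ] sumWords (λ w → g w b)
sumWords-∑ {t = zero}  g = refl
sumWords-∑ {t = suc t} g =
  trans (sum-cong-≗ (λ a → sumWords-∑ (λ w → g (a ∷ w))))
        (∑-comm (λ a b → sumWords (λ w → g (a ∷ w) b)))

-- Neighbourhoods in S(K_n, t)

lookup-const⇒replicate : ∀ {X : Set} {t} (w : Vec X t) (x : X) →
  (∀ k → lookup w k ≡ x) → w ≡ replicate t x
lookup-const⇒replicate []      x _   = refl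
lookup-const⇒replicate (y ∷ w) x w≡x = cong₂ _∷_ (w≡x zero) (lookup-const⇒replicate w x (w≡x ∘ suc))

module _ {n t : ℕ} {a : Fin n} {w w' : Word n t} where

  Adj-∷⁻ : Adj (a ∷ w) (a ∷ w') → Adj w w'
  Adj-∷⁻ (zero  , _ , a≢a , _) = ⊥-elim (a≢a refl)
  Adj-∷⁻ (suc i , before , differ , after) =
    i , (λ j j<i → before (suc j) (s≤s j<i)) , differ , (λ j i<j → after (suc j) (s≤s i<j))

  Adj-∷⁺ : Adj w w' → Adj (a ∷ w) (a ∷ w')
  Adj-∷⁺ (i , before , differ , after) = suc i , before′ , differ , after′
    where
    before′ : ∀ j → j Fin.< suc i → lookup (a ∷ w) j ≡ lookup (a ∷ w') j
    before′ zero    _         = refl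
    before′ (suc j) (s≤s j<i) = before j j<i
    after′ : ∀ j → suc i Fin.< j →
             (lookup (a ∷ w) j ≡ lookup (a ∷ w') (suc i)) × (lookup (a ∷ w') j ≡ lookup (a ∷ w) (suc i))
    after′ (suc j) (s≤s i<j) = after j i<j

  Adj-bridge⁻ : ∀ {b} → a ≢ b → Adj (a ∷ w) (b ∷ w') → w ≡ replicate t b × w' ≡ replicate t a
  Adj-bridge⁻ {b} a≢b (zero , _ , _ , after) =
    lookup-const⇒replicate w b (λ k → proj₁ (after (suc k) (s≤s z≤n))) ,
    lookup-const⇒replicate w' a (λ k → proj₂ (after (suc k) (s≤s z≤n)))
  Adj-bridge⁻ a≢b (suc i , before , _ , _) = ⊥-elim (a≢b (before zero (s≤s z≤n)))

Adj-bridge⁺ : ∀ {n t} {a b : Fin n} → a ≢ b → Adj (a ∷ replicate t b) (b ∷ replicate t a)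
Adj-bridge⁺ {t = t} {a} {b} a≢b = zero {t} , (λ _ ()) , a≢b , after
  where
  after : ∀ (j : Fin (suc t)) → zero {t} Fin.< j →
          (lookup (a ∷ replicate t b) j ≡ b) × (lookup (b ∷ replicate t a) j ≡ a)
  after (suc k) _ = lookup-replicate k b , lookup-replicate k a

when-adj?-∷ : ∀ {n s} (a b : Fin n) (w w' : Word n s) m →
  when (adj? (a ∷ w) (b ∷ w')) m
    ≡ when (a ≟ b) (when (adj? w w') m)
      + unless (a ≟ b) (when (w ≟ʷ replicate s b) (when (w' ≟ʷ replicate s a) m))
when-adj?-∷ {s = s} a b w w' m = split (a ≟ b)
  where
  split : (d : Dec (a ≡ b)) → when (adj? (a ∷ w) (b ∷ w')) m
    ≡ when d (when (adj? w w') m) + unless d (when (w ≟ʷ replicate s b) (when (w' ≟ʷ replicate s a) m))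
  split (yes refl) = trans (when-cong Adj-∷⁻ Adj-∷⁺ (adj? (a ∷ w) (a ∷ w')) (adj? w w') m)
                           (sym (+-identityʳ _))
  split (no a≢b)   = when-× (λ { refl refl → Adj-bridge⁺ a≢b })
                            (proj₁ ∘ Adj-bridge⁻ a≢b) (proj₂ ∘ Adj-bridge⁻ a≢b)
                            (adj? (a ∷ w) (b ∷ w')) (w ≟ʷ replicate s b) (w' ≟ʷ replicate s a) m

-- A vertex a ∷ w of S(K_n, s + 1) has its neighbours a ∷ w' in its own copy of S(K_n, s),
-- plus the neighbour b ∷ aˢ in the copy b when w = bˢ and b ≢ a.
bridge : ∀ {n s} → (Word n (suc s) → ℕ) → Fin n → Word n s → Fin n → ℕ
bridge {s = s} f a w b = unless (a ≟ b) (when (w ≟ʷ replicate s b) (f (b ∷ replicate s a)))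

nbrSumRec : ∀ {n t} → (Word n t → ℕ) → Word n t → ℕ
nbrSumRec {t = zero}  f []      = 0
nbrSumRec {t = suc s} f (a ∷ w) = nbrSumRec (λ w' → f (a ∷ w')) w + ∑[ b < _ ] bridge f a w b

-- The summand of `nbrSum` is local to its definition; `nbrSum-summand` names it
-- through a metavariable that `refl` solves.
private
  mutual
    nbrSummand : ∀ {n t} → (Word n t → ℕ) → Word n t → Word n t → ℕ
    nbrSummand f v = _

    nbrSum-summand : ∀ {n t} (f : Word n t → ℕ) v → nbrSum f v ≡ listSum (map (nbrSummand f v) (allWords n t))
    nbrSum-summand f v = refl

  nbrSummand≡when : ∀ {n t} (f : Word n t → ℕ) v u → nbrSummand f v u ≡ when (adj? v u) (f u)
  nbrSummand≡when f v u with adj? v u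
  ... | yes _ = refl
  ... | no _  = refl

nbrSum≡sumWords : ∀ {n t} (f : Word n t → ℕ) v → nbrSum f v ≡ sumWords (λ u → when (adj? v u) (f u))
nbrSum≡sumWords f v = trans (sum-allWords (nbrSummand f v)) (sumWords-cong (nbrSummand≡when f v))

sumWords-when-adj? : ∀ {n t} (f : Word n t → ℕ) v → sumWords (λ u → when (adj? v u) (f u)) ≡ nbrSumRec f v
sumWords-when-adj? {n} {zero} f [] = when-no (λ { (() , _) }) (adj? {n} {0} [] []) (f [])
sumWords-when-adj? {n} {suc s} f (a ∷ w) = begin
  ∑[ b < n ] sumWords (λ w' → when (adj? (a ∷ w) (b ∷ w')) (f (b ∷ w')))
    ≡⟨ sum-cong-≗ (λ b → sumWords-cong (λ w' → when-adj?-∷ a b w w' (f (b ∷ w')))) ⟩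
  ∑[ b < n ] sumWords (λ w' → inCopy b w' + acrossBridge b w')
    ≡⟨ sum-cong-≗ (λ b → sumWords-distrib-+ (inCopy b) (acrossBridge b)) ⟩
  ∑[ b < n ] (sumWords (inCopy b) + sumWords (acrossBridge b))
    ≡⟨ ∑-distrib-+ (λ b → sumWords (inCopy b)) (λ b → sumWords (acrossBridge b)) ⟩
  ∑[ b < n ] sumWords (inCopy b) + ∑[ b < n ] sumWords (acrossBridge b)
    ≡⟨ cong₂ _+_ inCopy-sum (sum-cong-≗ acrossBridge-sum) ⟩
  nbrSumRec (λ w' → f (a ∷ w')) w + ∑[ b < n ] bridge f a w b ∎
  where
  open ≡-Reasoning
  inCopy : Fin n → Word n s → ℕ
  inCopy b w' = when (a ≟ b) (when (adj? w w') (f (b ∷ w')))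
  acrossBridge : Fin n → Word n s → ℕ
  acrossBridge b w' = unless (a ≟ b) (when (w ≟ʷ replicate s b) (when (w' ≟ʷ replicate s a) (f (b ∷ w'))))
  inCopy-sum : ∑[ b < n ] sumWords (inCopy b) ≡ nbrSumRec (λ w' → f (a ∷ w')) w
  inCopy-sum = begin
    ∑[ b < n ] sumWords (inCopy b)
      ≡⟨ sum-cong-≗ (λ b → sumWords-when (a ≟ b) (λ w' → when (adj? w w') (f (b ∷ w')))) ⟩
    ∑[ b < n ] when (a ≟ b) (sumWords (λ w' → when (adj? w w') (f (b ∷ w'))))
      ≡⟨ ∑-when-≟ a (λ b → sumWords (λ w' → when (adj? w w') (f (b ∷ w')))) ⟩
    sumWords (λ w' → when (adj? w w') (f (a ∷ w')))
      ≡⟨ sumWords-when-adj? (λ w' → f (a ∷ w')) w ⟩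
    nbrSumRec (λ w' → f (a ∷ w')) w ∎
  acrossBridge-sum : ∀ b → sumWords (acrossBridge b) ≡ bridge f a w b
  acrossBridge-sum b = begin
    sumWords (acrossBridge b)
      ≡⟨ sumWords-unless (a ≟ b) (λ w' → when (w ≟ʷ replicate s b) (when (w' ≟ʷ replicate s a) (f (b ∷ w')))) ⟩
    unless (a ≟ b) (sumWords (λ w' → when (w ≟ʷ replicate s b) (when (w' ≟ʷ replicate s a) (f (b ∷ w')))))
      ≡⟨ cong (unless (a ≟ b)) (sumWords-when (w ≟ʷ replicate s b) (λ w' → when (w' ≟ʷ replicate s a) (f (b ∷ w')))) ⟩
    unless (a ≟ b) (when (w ≟ʷ replicate s b) (sumWords (λ w' → when (w' ≟ʷ replicate s a) (f (b ∷ w')))))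
      ≡⟨ cong (unless (a ≟ b) ∘ when (w ≟ʷ replicate s b)) (sumWords-when-≟ (replicate s a) (λ w' → f (b ∷ w'))) ⟩
    bridge f a w b ∎

nbrSum≡nbrSumRec : ∀ {n t} (f : Word n t → ℕ) v → nbrSum f v ≡ nbrSumRec f v
nbrSum≡nbrSumRec f v = trans (nbrSum≡sumWords f v) (sumWords-when-adj? f v)

-- Lower bound

-- Double counting: every vertex has degree n, except the n extreme vertices cᵗ of degree n ∸ 1.
handshake : ∀ {n t} (f : Word n t → ℕ) →
  sumWords (nbrSumRec f) + ∑[ c < n ] f (replicate t c) ≡ n * sumWords f
handshake {n} {zero}  f = ∑-const n (f [])
handshake {n} {suc s} f = begin
  sumWords (nbrSumRec f) + ∑[ c < n ] f (c ∷ replicate s c)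
    ≡⟨ cong (_+ ∑[ c < n ] f (c ∷ replicate s c)) (sum-cong-≗ (λ a →
         trans (sumWords-distrib-+ (nbrSumRec (f ∘ (a ∷_))) (λ w → ∑[ b < n ] bridge f a w b))
               (cong (sumWords (nbrSumRec (f ∘ (a ∷_))) +_) (bridges-sum a)))) ⟩
  ∑[ a < n ] (inner a + across a) + ∑[ a < n ] f (a ∷ replicate s a)
    ≡⟨ cong (_+ ∑[ a < n ] f (a ∷ replicate s a)) (∑-distrib-+ inner across) ⟩
  sum inner + sum across + ∑[ a < n ] f (a ∷ replicate s a)
    ≡⟨ +-assoc (sum inner) (sum across) _ ⟩
  sum inner + (sum across + ∑[ a < n ] f (a ∷ replicate s a))
    ≡⟨ cong (sum inner +_) (∑-distrib-+ across (λ a → f (a ∷ replicate s a))) ⟨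
  sum inner + ∑[ a < n ] (across a + f (a ∷ replicate s a))
    ≡⟨ cong (sum inner +_) (sum-cong-≗ (λ a → ∑-unless-≟ a (λ b → f (b ∷ replicate s a)))) ⟩
  sum inner + ∑[ a < n ] ∑[ b < n ] f (b ∷ replicate s a)
    ≡⟨ cong (sum inner +_) (∑-comm (λ a b → f (b ∷ replicate s a))) ⟩
  sum inner + ∑[ a < n ] ∑[ c < n ] f (a ∷ replicate s c)
    ≡⟨ ∑-distrib-+ inner (λ a → ∑[ c < n ] f (a ∷ replicate s c)) ⟨
  ∑[ a < n ] (inner a + ∑[ c < n ] f (a ∷ replicate s c))
    ≡⟨ sum-cong-≗ (λ a → handshake (f ∘ (a ∷_))) ⟩
  ∑[ a < n ] (n * sumWords (f ∘ (a ∷_)))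
    ≡⟨ *-distribˡ-sum n (λ a → sumWords (f ∘ (a ∷_))) ⟨
  n * sumWords f ∎
  where
  open ≡-Reasoning
  inner across : Fin n → ℕ
  inner a  = sumWords (nbrSumRec (f ∘ (a ∷_)))
  across a = ∑[ b < n ] unless (a ≟ b) (f (b ∷ replicate s a))
  bridges-sum : ∀ a → sumWords (λ w → ∑[ b < n ] bridge f a w b) ≡ across a
  bridges-sum a = trans (sumWords-∑ (λ w b → bridge f a w b)) (sum-cong-≗ (λ b →
    trans (sumWords-unless (a ≟ b) (λ w → when (w ≟ʷ replicate s b) (f (b ∷ replicate s a))))
          (cong (unless (a ≟ b)) (sumWords-when-≟ (replicate s b) (λ _ → f (b ∷ replicate s a))))))

-- c is the weight on a clique K_n and nb x the neighbour sum of its vertex x.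
clique-bound : ∀ {n} (c nb : Fin n → ℕ) → (∀ x → sum c ≤ nb x + c x) → (∀ x → c x ≡ 0 → 2 ≤ nb x) →
  2 * n ∸ 2 ≤ sum nb
clique-bound {n} c nb sees-clique dominated with sum c ≤? 1
... | yes Σc≤1 = m≤n+o⇒m∸n≤o (2 * n) 2 (begin
  2 * n                              ≡⟨ *-comm 2 n ⟩
  n * 2                              ≡⟨ ∑-const n 2 ⟨
  ∑[ x < n ] 2                       ≤⟨ ∑-mono-≤ (λ x → collects-2 (c x) (dominated x)) ⟩
  ∑[ x < n ] (2 * c x + nb x)        ≡⟨ ∑-distrib-+ (λ x → 2 * c x) nb ⟩
  ∑[ x < n ] (2 * c x) + sum nb      ≡⟨ cong (_+ sum nb) (*-distribˡ-sum 2 c) ⟨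
  2 * sum c + sum nb                 ≤⟨ +-monoˡ-≤ (sum nb) (*-monoʳ-≤ 2 Σc≤1) ⟩
  2 + sum nb                         ∎)
  where
  open ≤-Reasoning
  collects-2 : ∀ {m} k → (k ≡ 0 → 2 ≤ m) → 2 ≤ 2 * k + m
  collects-2 zero    k≡0⇒2≤m = k≡0⇒2≤m refl
  collects-2 (suc k) _       = ≤-trans (*-monoʳ-≤ 2 (s≤s z≤n)) (m≤m+n (2 * suc k) _)
... | no Σc≰1 = begin
  2 * n ∸ 2                          ≡⟨ cong (_∸ 2) (*-comm 2 n) ⟩
  n * 2 ∸ 1 * 2                      ≡⟨ *-distribʳ-∸ 2 n 1 ⟨
  (n ∸ 1) * 2                        ≤⟨ *-monoʳ-≤ (n ∸ 1) (≰⇒> Σc≰1) ⟩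
  (n ∸ 1) * sum c                    ≡⟨ *-distribʳ-∸ (sum c) n 1 ⟩
  n * sum c ∸ 1 * sum c              ≡⟨ cong (n * sum c ∸_) (*-identityˡ (sum c)) ⟩
  n * sum c ∸ sum c                  ≤⟨ m≤n+o⇒m∸n≤o (n * sum c) (sum c) (begin
    n * sum c                          ≡⟨ ∑-const n (sum c) ⟨
    ∑[ x < n ] sum c                   ≤⟨ ∑-mono-≤ sees-clique ⟩
    ∑[ x < n ] (nb x + c x)            ≡⟨ ∑-distrib-+ nb c ⟩
    sum nb + sum c                     ≡⟨ +-comm (sum nb) (sum c) ⟩
    sum c + sum nb                     ∎) ⟩
  sum nb                             ∎
  where open ≤-Reasoning

-- h is the weight a vertex receives across bridges of outer levels; the innermost copies
-- of S(K_n, 1) are cliques.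
nbrSumRec-bound : ∀ {n s} (f h : Word n (suc s) → ℕ) → (∀ v → f v ≡ 0 → 2 ≤ nbrSumRec f v + h v) →
  (2 * n ∸ 2) * n ^ s ≤ sumWords (λ v → nbrSumRec f v + h v)
nbrSumRec-bound {n} {zero} f h dominated =
  subst (_≤ sum nb) (sym (*-identityʳ (2 * n ∸ 2))) (clique-bound c nb sees-clique (λ x → dominated (x ∷ [])))
  where
  c nb : Fin n → ℕ
  c b  = f (b ∷ [])
  nb x = nbrSumRec f (x ∷ []) + h (x ∷ [])
  sees-clique : ∀ x → sum c ≤ nb x + c x
  sees-clique x = begin
    sum c                                    ≡⟨ ∑-unless-≟ x c ⟨
    ∑[ b < n ] unless (x ≟ b) (c b) + c x    ≡⟨ cong (_+ c x) (sum-cong-≗ (λ b →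
                                                  cong (unless (x ≟ b)) (sym (when-yes refl (_≟ʷ_ {n} [] []) (c b))))) ⟩
    ∑[ b < n ] bridge f x [] b + c x         ≤⟨ +-monoˡ-≤ (c x) (m≤m+n _ (h (x ∷ []))) ⟩
    nb x + c x                               ∎
    where open ≤-Reasoning
nbrSumRec-bound {n} {suc s} f h dominated = begin
  (2 * n ∸ 2) * (n * n ^ s)                           ≡⟨ x∙yz≈y∙xz (2 * n ∸ 2) n (n ^ s) ⟩
  n * ((2 * n ∸ 2) * n ^ s)                           ≡⟨ ∑-const n _ ⟨
  ∑[ a < n ] ((2 * n ∸ 2) * n ^ s)                    ≤⟨ ∑-mono-≤ (λ a → nbrSumRec-bound (f ∘ (a ∷_)) (h′ a) (dominated′ a)) ⟩
  ∑[ a < n ] sumWords (λ w → nbrSumRec (f ∘ (a ∷_)) w + h′ a w)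
                                                      ≡⟨ sum-cong-≗ (λ a → sumWords-cong (λ w → sym (bridges+h w a))) ⟩
  sumWords (λ v → nbrSumRec f v + h v)                ∎
  where
  open ≤-Reasoning
  h′ : Fin n → Word n (suc s) → ℕ
  h′ a w = ∑[ b < n ] bridge f a w b + h (a ∷ w)
  bridges+h : ∀ w a → nbrSumRec f (a ∷ w) + h (a ∷ w) ≡ nbrSumRec (f ∘ (a ∷_)) w + h′ a w
  bridges+h w a = +-assoc (nbrSumRec (f ∘ (a ∷_)) w) (∑[ b < n ] bridge f a w b) (h (a ∷ w))
  dominated′ : ∀ a v → f (a ∷ v) ≡ 0 → 2 ≤ nbrSumRec (f ∘ (a ∷_)) v + h′ a v
  dominated′ a v fv≡0 = subst (2 ≤_) (bridges+h v a) (dominated (a ∷ v) fv≡0)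

italian-lower-bound : ∀ n s .{{_ : NonZero n}} (f : Word n (2 + s) → ℕ) → IsIDF n (2 + s) f →
  n ^ s * (2 * n ∸ 2) ≤ weight f
italian-lower-bound n s f (_ , dominated) = subst (_ ≤_) (sym (sum-allWords f)) (*-cancelˡ-≤ n (begin
  n * (n ^ s * (2 * n ∸ 2))                 ≡⟨ x∙yz≈z∙xy n (n ^ s) (2 * n ∸ 2) ⟩
  (2 * n ∸ 2) * n ^ suc s                   ≤⟨ nbrSumRec-bound f (λ _ → 0) dominated′ ⟩
  sumWords (λ v → nbrSumRec f v + 0)        ≡⟨ sumWords-cong (λ v → +-identityʳ (nbrSumRec f v)) ⟩
  sumWords (nbrSumRec f)                    ≤⟨ m≤m+n (sumWords (nbrSumRec f)) _ ⟩
  sumWords (nbrSumRec f) + ∑[ c < n ] f (replicate (2 + s) c) ≡⟨ handshake f ⟩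
  n * sumWords f                            ∎))
  where
  open ≤-Reasoning
  dominated′ : ∀ v → f v ≡ 0 → 2 ≤ nbrSumRec f v + 0
  dominated′ v fv≡0 = subst (2 ≤_) (trans (nbrSum≡nbrSumRec f v) (sym (+-identityʳ _))) (dominated v fv≡0)

-- An optimal Italian dominating function

module Optimal (m : ℕ) where

  k n : ℕ
  k = 2 + m
  n = suc k

  prev next : Fin n → Fin n
  prev zero    = fromℕ k
  prev (suc j) = inject₁ j
  next i with toℕ i ℕ.<? k
  ... | yes i<k = suc (fromℕ< i<k)
  ... | no  _   = zero

  toℕ≮k⇒≡k : ∀ (i : Fin n) → ¬ toℕ i ℕ.< k → toℕ i ≡ k
  toℕ≮k⇒≡k i i≮k = ≤-antisym (Fin.toℕ≤pred[n] i) (≮⇒≥ i≮k)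

  prev-next : ∀ l → prev (next l) ≡ l
  prev-next l with toℕ l ℕ.<? k
  ... | yes l<k = Fin.toℕ-injective (trans (Fin.toℕ-inject₁ (fromℕ< l<k)) (Fin.toℕ-fromℕ< l<k))
  ... | no  l≮k = Fin.toℕ-injective (trans (Fin.toℕ-fromℕ k) (sym (toℕ≮k⇒≡k l l≮k)))

  next≢id : ∀ l → next l ≢ l
  next≢id l with toℕ l ℕ.<? k
  ... | yes l<k = λ eq → 1+n≢n (trans (cong suc (sym (Fin.toℕ-fromℕ< l<k))) (cong toℕ eq))
  ... | no  l≮k = λ eq → 0≢1+n (trans (cong toℕ eq) (toℕ≮k⇒≡k l l≮k))

  prev≢next : ∀ l → prev l ≢ next l
  prev≢next zero with toℕ (zero {k}) ℕ.<? k
  ... | yes _   = λ eq → 0≢1+n (sym (suc-injective (trans (sym (Fin.toℕ-fromℕ k)) (cong toℕ eq))))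
  ... | no  0≮k = ⊥-elim (0≮k (s≤s z≤n))
  prev≢next (suc j) with toℕ (suc j) ℕ.<? k
  ... | yes j+1<k = λ eq → m≢1+n+m (toℕ j) {1}
                      (trans (sym (Fin.toℕ-inject₁ j)) (trans (cong toℕ eq) (cong suc (Fin.toℕ-fromℕ< j+1<k))))
  ... | no  j+1≮k = λ eq → 0≢1+n (suc-injective
                      (trans (cong suc (trans (sym (cong toℕ eq)) (Fin.toℕ-inject₁ j))) (toℕ≮k⇒≡k (suc j) j+1≮k)))

  avoids : Fin n → Fin n → ℕ
  avoids l x = unless (prev l ≟ x) (unless (next l ≟ x) 1)

  italian₃ : Fin n → Fin n → Fin n → ℕ
  italian₃ l x y = when (prev l ≟ y) 1 + when (next l ≟ y) (avoids l x)

  italian : ∀ s → Word n (3 + s) → ℕ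
  italian zero    (l ∷ x ∷ y ∷ []) = italian₃ l x y
  italian (suc s) (_ ∷ w)          = italian s w

  italian₃≤2 : ∀ l x y → italian₃ l x y ≤ 2
  italian₃≤2 l x y = +-mono-≤ (when-≤ (prev l ≟ y) 1)
    (≤-trans (when-≤ (next l ≟ y) _) (≤-trans (unless-≤ (prev l ≟ x) _) (unless-≤ (next l ≟ x) 1)))

  italian≤2 : ∀ s v → italian s v ≤ 2
  italian≤2 zero    (l ∷ x ∷ y ∷ []) = italian₃≤2 l x y
  italian≤2 (suc s) (_ ∷ w)          = italian≤2 s w

  1≤italian₃-prev : ∀ l x → 1 ≤ italian₃ l x (prev l)
  1≤italian₃-prev l x = ≤-trans (≤-reflexive (sym (when-yes refl (prev l ≟ prev l) 1))) (m≤m+n _ _)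

  1≤italian₃-next : ∀ {l x} → prev l ≢ x → next l ≢ x → 1 ≤ italian₃ l x (next l)
  1≤italian₃-next {l} {x} prev≢x next≢x = ≤-trans
    (≤-reflexive (sym (trans (when-yes refl (next l ≟ next l) _)
                      (trans (unless-no prev≢x (prev l ≟ x) _) (unless-no next≢x (next l ≟ x) 1)))))
    (m≤n+m _ _)

  dominated₃ : ∀ l x y → italian₃ l x y ≡ 0 → 2 ≤ nbrSumRec (italian zero) (l ∷ x ∷ y ∷ [])
  dominated₃ l x y italian≡0 = by-cases (next l ≟ y) (prev l ≟ x) (next l ≟ x)
    where
    inClique inMiddle atTop : Fin n → ℕ
    inClique b = bridge (λ w → italian zero (l ∷ x ∷ w)) y [] b
    inMiddle b = bridge (λ w → italian zero (l ∷ w)) x (y ∷ []) b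
    atTop    b = bridge (italian zero) l (x ∷ y ∷ []) b

    inClique≡ : ∀ {b} → y ≢ b → inClique b ≡ italian₃ l x b
    inClique≡ {b} y≢b = trans (unless-no y≢b (y ≟ b) _) (when-yes refl (_≟ʷ_ {n} [] []) (italian₃ l x b))
    inMiddle≡ : x ≢ y → inMiddle y ≡ italian₃ l y x
    inMiddle≡ x≢y = trans (unless-no x≢y (x ≟ y) _) (when-yes refl ((y ∷ []) ≟ʷ (y ∷ [])) (italian₃ l y x))
    atTop≡ : l ≢ y → x ≡ y → atTop y ≡ italian₃ y l l
    atTop≡ l≢y refl = trans (unless-no l≢y (l ≟ y) _) (when-yes refl ((y ∷ y ∷ []) ≟ʷ (y ∷ y ∷ [])) (italian₃ y l l))

    prev≢y : prev l ≢ y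
    prev≢y refl = 1+n≰n (≤-trans (1≤italian₃-prev l x) (≤-reflexive italian≡0))

    1≤inClique-prev : 1 ≤ inClique (prev l)
    1≤inClique-prev = subst (1 ≤_) (sym (inClique≡ (prev≢y ∘ sym))) (1≤italian₃-prev l x)

    with-middle : 1 ≤ inMiddle y → 2 ≤ sum inClique + sum inMiddle + sum atTop
    with-middle 1≤mid = ≤-trans (+-mono-≤ (≤-trans 1≤inClique-prev (term≤∑ (prev l) inClique))
                                          (≤-trans 1≤mid (term≤∑ y inMiddle))) (m≤m+n _ _)
    with-top : 1 ≤ atTop y → 2 ≤ sum inClique + sum inMiddle + sum atTop
    with-top 1≤top = +-mono-≤ (≤-trans (≤-trans 1≤inClique-prev (term≤∑ (prev l) inClique)) (m≤m+n _ _))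
                              (≤-trans 1≤top (term≤∑ y atTop))

    by-cases : Dec (next l ≡ y) → Dec (prev l ≡ x) → Dec (next l ≡ x) →
               2 ≤ sum inClique + sum inMiddle + sum atTop
    by-cases (no next≢y) (no prev≢x) (no next≢x) = ≤-trans
      (+-mono-≤ 1≤inClique-prev (subst (1 ≤_) (sym (inClique≡ (next≢y ∘ sym))) (1≤italian₃-next prev≢x next≢x)))
      (≤-trans (two-terms≤∑ (prev≢next l) inClique) (≤-trans (m≤m+n _ _) (m≤m+n _ _)))
    by-cases _ (yes refl) _ = with-middle
      (subst (1 ≤_) (sym (inMiddle≡ prev≢y)) (1≤italian₃-prev l y))
    by-cases (no next≢y) (no _) (yes refl) = with-middle
      (subst (1 ≤_) (sym (inMiddle≡ next≢y)) (1≤italian₃-next prev≢y next≢y))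
    by-cases (yes refl) (no _) (yes refl) = with-top
      (subst (1 ≤_) (sym (atTop≡ (next≢id l ∘ sym) refl)) (subst (1 ≤_) (cong (italian₃ (next l) l) (prev-next l))
        (1≤italian₃-prev (next l) l)))
    by-cases (yes refl) (no prev≢x) (no next≢x) =
      ⊥-elim (1+n≰n (≤-trans (1≤italian₃-next prev≢x next≢x) (≤-reflexive italian≡0)))

  dominated : ∀ s v → italian s v ≡ 0 → 2 ≤ nbrSumRec (italian s) v
  dominated zero    (l ∷ x ∷ y ∷ []) = dominated₃ l x y
  dominated (suc s) (_ ∷ w)          = λ italian≡0 → ≤-trans (dominated s w italian≡0) (m≤m+n _ _)

  italian-isIDF : ∀ s → IsIDF n (3 + s) (italian s)
  italian-isIDF s = italian≤2 s , λ v italian≡0 →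
    subst (2 ≤_) (sym (nbrSum≡nbrSumRec (italian s) v)) (dominated s v italian≡0)

  ∑-italian₃ : ∀ l x → ∑[ y < n ] italian₃ l x y ≡ 1 + avoids l x
  ∑-italian₃ l x = trans (∑-distrib-+ (λ y → when (prev l ≟ y) 1) (λ y → when (next l ≟ y) (avoids l x)))
    (cong₂ _+_ (∑-when-≟ (prev l) (λ _ → 1)) (∑-when-≟ (next l) (λ _ → avoids l x)))

  ∑-avoids : ∀ l → ∑[ x < n ] avoids l x + 2 ≡ n
  ∑-avoids l = begin
    sum (avoids l) + 2                               ≡⟨ +-assoc (sum (avoids l)) 1 1 ⟨
    sum (avoids l) + 1 + 1                           ≡⟨ cong (λ z → sum (avoids l) + z + 1) next≢prev ⟨
    sum (avoids l) + unless (next l ≟ prev l) 1 + 1  ≡⟨ cong (_+ 1) (∑-unless-≟ (prev l) (λ x → unless (next l ≟ x) 1)) ⟩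
    ∑[ x < n ] unless (next l ≟ x) 1 + 1             ≡⟨ ∑-unless-≟ (next l) (λ _ → 1) ⟩
    ∑[ x < n ] 1                                     ≡⟨ trans (∑-const n 1) (*-identityʳ n) ⟩
    n                                                ∎
    where
    open ≡-Reasoning
    next≢prev : unless (next l ≟ prev l) 1 ≡ 1
    next≢prev = unless-no (prev≢next l ∘ sym) (next l ≟ prev l) 1

  ∑∑-italian₃ : ∀ l → ∑[ x < n ] ∑[ y < n ] italian₃ l x y ≡ 2 * n ∸ 2
  ∑∑-italian₃ l = begin
    ∑[ x < n ] ∑[ y < n ] italian₃ l x y  ≡⟨ sum-cong-≗ (∑-italian₃ l) ⟩
    ∑[ x < n ] (1 + avoids l x)          ≡⟨ ∑-distrib-+ (λ _ → 1) (avoids l) ⟩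
    ∑[ x < n ] 1 + sum (avoids l)        ≡⟨ cong (_+ sum (avoids l)) (trans (∑-const n 1) (*-identityʳ n)) ⟩
    n + sum (avoids l)                   ≡⟨ m+n∸n≡m (n + sum (avoids l)) 2 ⟨
    n + sum (avoids l) + 2 ∸ 2           ≡⟨ cong (_∸ 2) (trans (+-assoc n (sum (avoids l)) 2) (cong (n +_) (∑-avoids l))) ⟩
    n + n ∸ 2                            ≡⟨ cong (λ z → n + z ∸ 2) (+-identityʳ n) ⟨
    2 * n ∸ 2                            ∎
    where open ≡-Reasoning

  weight-italian : ∀ s → weight (italian s) ≡ n ^ suc s * (2 * n ∸ 2)
  weight-italian s = trans (sum-allWords (italian s)) (sumWords-italian s)
    where
    sumWords-italian : ∀ s → sumWords (italian s) ≡ n ^ suc s * (2 * n ∸ 2)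
    sumWords-italian zero    = trans (sum-cong-≗ ∑∑-italian₃)
      (trans (∑-const n (2 * n ∸ 2)) (cong (_* (2 * n ∸ 2)) (sym (*-identityʳ n))))
    sumWords-italian (suc s) = trans (∑-const n (sumWords (italian s)))
      (trans (cong (n *_) (sumWords-italian s)) (sym (*-assoc n (n ^ suc s) (2 * n ∸ 2))))

corollary3p3 : (n t : ℕ) → 3 ≤ n → 3 ≤ t →
    ItalianDominationNumber n t ((n ^ (t ∸ 2)) * (2 * n ∸ 2))
corollary3p3 n@(suc (suc (suc m))) (suc (suc (suc s))) (s≤s (s≤s (s≤s _))) (s≤s (s≤s (s≤s _))) =
  (italian s , italian-isIDF s , weight-italian s) , italian-lower-bound n (suc s)
  where open Optimal m using (italian; italian-isIDF; weight-italian)
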